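{- Let $M$ be a finite monoid and $s,x,y\in M$. If $s\mathrel{\mathcal R}sx$ and $x\sim_{\mathbf K}y$, then $sx=sy$. If $s\mathrel{\mathcal L}xs$ and $x\sim_{\mathbf D}y$, then $xs=ys$.
   Context: For a finite monoid $M$: $u\le_{\mathcal R}v$ iff $u=vq$ for some $q\in M$; $u\le_{\mathcal L}v$ iff $u=pv$ for some $p\in M$; $u\le_{\mathcal J}v$ iff $u=pvq$ for some $p,q\in M$; $u\mathrel{\mathcal R}v$ (resp. $\mathcal L$) iff $u\le_{\mathcal R}v$ and $v\le_{\mathcal R}u$ (resp. with $\le_{\mathcal L}$); $u<_{\mathcal J}v$ iff $u\le_{\mathcal J}v$ but not $v\le_{\mathcal J}u$. $E(M)$ is the set of idempotents. $u\sim_{\mathbf K}v$ iff for every $e\in E(M)$, either ($eu<_{\mathcal J}e$ and $ev<_{\mathcal J}e$) or $eu=ev$. $u\sim_{\mathbf D}v$ iff for every $f\in E(M)$, either ($uf<_{\mathcal J}f$ and $vf<_{\mathcal J}f$) or $uf=vf$. -}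

module Defs where

open import Level using (Level; suc; _⊔_)
open import Data.Nat using (ℕ)
open import Data.Fin using (Fin)
open import Data.Product using (Σ; ∃; ∃-syntax; _×_; _,_)
open import Data.Sum using (_⊎_)
open import Relation.Nullary using (¬_)
open import Relation.Binary.PropositionalEquality using (_≡_)
open import Function.Bundles using (_↔_)
open import Algebra.Bundles using (Monoid)

record FiniteMonoid (c : Level) : Set (suc c) where
  field
    monoid  : Monoid c c
  open Monoid monoid public
  field
    ≈-is-≡  : ∀ {a b} → a ≈ b → a ≡ b
    size    : ℕ
    enum    : Fin size ↔ Carrier

module Green {c : Level} (M : FiniteMonoid c) where
  open FiniteMonoid M public

  _≤R_ : Carrier → Carrier → Set c
  u ≤R v = ∃[ q ] (u ≡ v ∙ q)

  _≤L_ : Carrier → Carrier → Set c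
  u ≤L v = ∃[ p ] (u ≡ p ∙ v)

  _≤J_ : Carrier → Carrier → Set c
  u ≤J v = ∃[ p ] ∃[ q ] (u ≡ (p ∙ v) ∙ q)

  _R_ : Carrier → Carrier → Set c
  u R v = (u ≤R v) × (v ≤R u)

  _L_ : Carrier → Carrier → Set c
  u L v = (u ≤L v) × (v ≤L u)

  _<J_ : Carrier → Carrier → Set c
  u <J v = (u ≤J v) × ¬ (v ≤J u)

  IsIdempotent : Carrier → Set c
  IsIdempotent e = e ∙ e ≡ e

  _∼K_ : Carrier → Carrier → Set c
  u ∼K v = ∀ e → IsIdempotent e →
             (((e ∙ u) <J e) × ((e ∙ v) <J e)) ⊎ (e ∙ u ≡ e ∙ v)

  _∼D_ : Carrier → Carrier → Set c
  u ∼D v = ∀ f → IsIdempotent f →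
             (((u ∙ f) <J f) × ((v ∙ f) <J f)) ⊎ (u ∙ f ≡ v ∙ f)

-- Since s = s ∙ (x ∙ q), s is fixed on the right by every power of a = x ∙ q, in
-- particular by the idempotent power e = a ^ (k + 1) that exists because M is finite.
-- As e = (e ∙ x) ∙ (q ∙ a ^ k), the element e ∙ x is not strictly J-below e, so
-- x ∼K y forces e ∙ x = e ∙ y, and then s ∙ x = s ∙ e ∙ x = s ∙ e ∙ y = s ∙ y.
-- The second half is the first one in the opposite monoid: there s ≤L x ∙ s is
-- literally s ≤R s ∙ x, and ∼D turns into ∼K.
module Submission where

open import Defs
open import Level using (Level)
open import Data.Nat using (ℕ; zero; suc; _+_; _*_)
open import Data.Nat.Properties using (n<1+n; +-suc; +-comm; +-assoc; m≤n⇒∃[o]m+o≡n)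
open import Data.Nat.Tactic.RingSolver using (solve-∀)
open import Data.Fin using (toℕ)
open import Data.Fin.Properties using (pigeonhole)
open import Data.Product using (_×_; _,_; ∃-syntax; ∃₂)
open import Data.Sum using (inj₁; inj₂)
open import Data.Empty using (⊥-elim)
open import Function using (_∘_)
open import Function.Bundles using (Inverse; Injection)
open import Function.Properties.Inverse using (↔-sym; ↔⇒↣)
open import Relation.Binary.PropositionalEquality
import Algebra.Construct.Flip.Op as Op

opposite : {c : Level} → FiniteMonoid c → FiniteMonoid c
opposite M = record
  { monoid = Op.monoid monoid ; ≈-is-≡ = ≈-is-≡ ; size = size ; enum = enum }
  where open FiniteMonoid M

module _ {c : Level} (M : FiniteMonoid c) where
  open Green M using ( Carrier; _∙_; ε; assoc; identityˡ; identityʳ; ≈-is-≡; monoid; size; enum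
                    ; IsIdempotent; _≤R_; _≤J_; _<J_; _∼K_; _∼D_ )
  open import Algebra.Properties.Monoid.Mult monoid using (×-homo-+) renaming (_×_ to _·_)
  private module Mᵒᵖ = Green (opposite M)

  ∙-assoc : ∀ u v w → (u ∙ v) ∙ w ≡ u ∙ (v ∙ w)
  ∙-assoc u v w = ≈-is-≡ (assoc u v w)

  infixr 8 _^_
  _^_ : Carrier → ℕ → Carrier
  x ^ n = n · x

  ^-+ : ∀ x m n → x ^ (m + n) ≡ x ^ m ∙ x ^ n
  ^-+ x m n = ≈-is-≡ (×-homo-+ x m n)

  ^-shift : ∀ {x m p} → x ^ m ≡ x ^ (m + p) → ∀ k → x ^ (k + (m + p)) ≡ x ^ (k + m)
  ^-shift {x} {m} {p} period k = begin
    x ^ (k + (m + p))    ≡⟨ ^-+ x k (m + p) ⟩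
    x ^ k ∙ x ^ (m + p)  ≡⟨ cong (x ^ k ∙_) (sym period) ⟩
    x ^ k ∙ x ^ m        ≡⟨ ^-+ x k m ⟨
    x ^ (k + m)          ∎
    where open ≡-Reasoning

  ^-periodic : ∀ {x m p} → x ^ m ≡ x ^ (m + p) →
               ∀ r k → x ^ (k + (r * p + m)) ≡ x ^ (k + m)
  ^-periodic period zero    k = refl
  ^-periodic {x} {m} {p} period (suc r) k = begin
    x ^ (k + ((p + r * p) + m))  ≡⟨ cong (x ^_) (rearrange k p (r * p) m) ⟩
    x ^ ((k + r * p) + (m + p))  ≡⟨ ^-shift period (k + r * p) ⟩
    x ^ ((k + r * p) + m)        ≡⟨ cong (x ^_) (+-assoc k (r * p) m) ⟩
    x ^ (k + (r * p + m))        ≡⟨ ^-periodic period r k ⟩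
    x ^ (k + m)                  ∎
    where
    open ≡-Reasoning
    rearrange : ∀ k p q m → k + ((p + q) + m) ≡ (k + q) + (m + p)
    rearrange = solve-∀

  ^-idempotent : ∀ {x m d} → x ^ m ≡ x ^ (m + suc d) → IsIdempotent (x ^ (suc d * m))
  ^-idempotent {x} {m} {d} period = begin
    x ^ (suc d * m) ∙ x ^ (suc d * m)  ≡⟨ ^-+ x (suc d * m) (suc d * m) ⟨
    x ^ (suc d * m + suc d * m)        ≡⟨ cong (x ^_) (double d m) ⟩
    x ^ (d * m + (m * suc d + m))      ≡⟨ ^-periodic period m (d * m) ⟩
    x ^ (d * m + m)                    ≡⟨ cong (x ^_) (+-comm (d * m) m) ⟩
    x ^ (suc d * m)                    ∎
    where
    open ≡-Reasoning
    double : ∀ d m → suc d * m + suc d * m ≡ d * m + (m * suc d + m)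
    double = solve-∀

  from-enum-injective : ∀ {u v} → Inverse.from enum u ≡ Inverse.from enum v → u ≡ v
  from-enum-injective = Injection.injective (↔⇒↣ (↔-sym enum))

  ^-repeats : ∀ x → ∃₂ λ i d → x ^ suc i ≡ x ^ (suc i + suc d)
  ^-repeats x
    with i , j , i<j , same-index ← pigeonhole (n<1+n size) (λ i → Inverse.from enum (x ^ suc (toℕ i)))
    with d , i+1+d≡j ← m≤n⇒∃[o]m+o≡n i<j
    = toℕ i , d , (begin
      x ^ suc (toℕ i)            ≡⟨ from-enum-injective same-index ⟩
      x ^ suc (toℕ j)            ≡⟨ cong (λ n → x ^ suc n) i+1+d≡j ⟨
      x ^ suc (suc (toℕ i) + d)  ≡⟨ cong (x ^_) (+-suc (suc (toℕ i)) d) ⟨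
      x ^ (suc (toℕ i) + suc d)  ∎)
    where open ≡-Reasoning

  idempotent-power : ∀ x → ∃[ k ] IsIdempotent (x ^ suc k)
  idempotent-power x with i , d , period ← ^-repeats x =
    i + d * suc i , ^-idempotent {x} {suc i} period

  ∙-fixes-^ : ∀ {s a} → s ∙ a ≡ s → ∀ n → s ∙ a ^ n ≡ s
  ∙-fixes-^ {s} sa≡s zero    = ≈-is-≡ (identityʳ s)
  ∙-fixes-^ {s} {a} sa≡s (suc n) = begin
    s ∙ (a ∙ a ^ n)  ≡⟨ ∙-assoc s a (a ^ n) ⟨
    (s ∙ a) ∙ a ^ n  ≡⟨ cong (_∙ a ^ n) sa≡s ⟩
    s ∙ a ^ n        ≡⟨ ∙-fixes-^ sa≡s n ⟩
    s                ∎
    where open ≡-Reasoning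

  ≤R⇒≤J : ∀ {u v} → u ≤R v → u ≤J v
  ≤R⇒≤J {v = v} (q , u≡vq) = ε , q , trans u≡vq (cong (_∙ q) (sym (≈-is-≡ (identityˡ v))))

  idempotent-power-≤R : ∀ x q (k : ℕ) → IsIdempotent ((x ∙ q) ^ suc k) →
                        ((x ∙ q) ^ suc k) ≤R ((x ∙ q) ^ suc k ∙ x)
  idempotent-power-≤R x q k e-idem = q ∙ (x ∙ q) ^ k , (begin
    e                            ≡⟨ e-idem ⟨
    e ∙ ((x ∙ q) ∙ (x ∙ q) ^ k)  ≡⟨ cong (e ∙_) (∙-assoc x q _) ⟩
    e ∙ (x ∙ (q ∙ (x ∙ q) ^ k))  ≡⟨ ∙-assoc e x _ ⟨
    (e ∙ x) ∙ (q ∙ (x ∙ q) ^ k)  ∎)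
    where
    open ≡-Reasoning
    e = (x ∙ q) ^ suc k

  factor-through : ∀ {s e x y} → s ∙ e ≡ s → e ∙ x ≡ e ∙ y → s ∙ x ≡ s ∙ y
  factor-through {s} {e} {x} {y} se≡s ex≡ey = begin
    s ∙ x        ≡⟨ cong (_∙ x) se≡s ⟨
    (s ∙ e) ∙ x  ≡⟨ ∙-assoc s e x ⟩
    s ∙ (e ∙ x)  ≡⟨ cong (s ∙_) ex≡ey ⟩
    s ∙ (e ∙ y)  ≡⟨ ∙-assoc s e y ⟨
    (s ∙ e) ∙ y  ≡⟨ cong (_∙ y) se≡s ⟩
    s ∙ y        ∎
    where open ≡-Reasoning

  ≤R-cancel-∼K : ∀ {s x y} → s ≤R (s ∙ x) → x ∼K y → s ∙ x ≡ s ∙ y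
  ≤R-cancel-∼K {s} {x} {y} (q , s≡sxq) x∼y
    with k , e-idem ← idempotent-power (x ∙ q)
    with x∼y ((x ∙ q) ^ suc k) e-idem
  ... | inj₁ ((_ , e≰ex) , _) = ⊥-elim (e≰ex (≤R⇒≤J (idempotent-power-≤R x q k e-idem)))
  ... | inj₂ ex≡ey = factor-through (∙-fixes-^ s∙xq≡s (suc k)) ex≡ey
    where
    s∙xq≡s : s ∙ (x ∙ q) ≡ s
    s∙xq≡s = sym (trans s≡sxq (∙-assoc s x q))

  ≤J⇒≤Jᵒᵖ : ∀ {u v} → u ≤J v → u Mᵒᵖ.≤J v
  ≤J⇒≤Jᵒᵖ {v = v} (p , q , u≡pvq) = q , p , trans u≡pvq (∙-assoc p v q)

  ≤Jᵒᵖ⇒≤J : ∀ {u v} → u Mᵒᵖ.≤J v → u ≤J v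
  ≤Jᵒᵖ⇒≤J {v = v} (p , q , u≡qvp) = q , p , trans u≡qvp (sym (∙-assoc q v p))

  <J⇒<Jᵒᵖ : ∀ {u v} → u <J v → u Mᵒᵖ.<J v
  <J⇒<Jᵒᵖ (u≤v , v≰u) = ≤J⇒≤Jᵒᵖ u≤v , v≰u ∘ ≤Jᵒᵖ⇒≤J

  ∼D⇒∼Kᵒᵖ : ∀ {x y} → x ∼D y → x Mᵒᵖ.∼K y
  ∼D⇒∼Kᵒᵖ x∼y f f-idem with x∼y f f-idem
  ... | inj₁ (xf<f , yf<f) = inj₁ (<J⇒<Jᵒᵖ xf<f , <J⇒<Jᵒᵖ yf<f)
  ... | inj₂ xf≡yf         = inj₂ xf≡yf

lemma1 : {c : Level} (M : FiniteMonoid c) →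
         let open Green M in
         (s x y : Carrier) →
         ((s R (s ∙ x)) → x ∼K y → s ∙ x ≡ s ∙ y) ×
         ((s L (x ∙ s)) → x ∼D y → x ∙ s ≡ y ∙ s)
lemma1 M s x y =
  (λ (s≤sx , _) → ≤R-cancel-∼K M s≤sx) ,
  (λ (s≤xs , _) x∼y → ≤R-cancel-∼K (opposite M) s≤xs (∼D⇒∼Kᵒᵖ M x∼y))
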